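{- Let $\boxtimes$ denote either the normal product $\boxtimes_{\min}$ or the strong product $\boxtimes_{\max}$. Let $H$ be a hypergraph and $H\cong H_1\boxtimes H_2$ an arbitrary factorization of $H$. Then an edge $e$ of $H$ is Cartesian with respect to $H_1\boxtimes H_2$ if and only if every $e'\in E([H]_2)$ with $e'\subseteq e$ is Cartesian in the graph $[H_1]_2\boxtimes[H_2]_2=[H]_2$.
   Context: All hypergraphs $H=(V,E)$ are finite ($E$ a set of nonempty subsets of $V$), simple ($|e|\ge2$ for all edges, no edge properly contained in another) and connected. The $2$-section $[H]_2$ is the graph on $V$ whose edges are the pairs $\{x,y\}$, $x\ne y$, contained in some edge of $H$. Products of $H_1=(V_1,E_1)$, $H_2=(V_2,E_2)$ have vertex set $V_1\times V_2$ with projections $p_1,p_2$. Cartesian product: $e$ is an edge iff for some $\{i,j\}=\{1,2\}$, $p_i(e)\in E_i$ and $|p_j(e)|=1$. Strong product $\boxtimes_{\max}$: $e$ is an edge iff it is an edge of the Cartesian product, or $p_i(e)\in E_i$ for $i=1,2$ and $|e|=\max_i|p_i(e)|$. Normal product $\boxtimes_{\min}$: $e$ is an edge iff it is an edge of the Cartesian product, or there are $e_i\in E_i$ with $p_i(e)\subseteq e_i$ ($i=1,2$) and $|e|=|p_1(e)|=|p_2(e)|=\min\{|e_1|,|e_2|\}$. For graphs both products coincide with the usual strong graph product, and $[H_1\boxtimes H_2]_2=[H_1]_2\boxtimes[H_2]_2$. An edge of $H_1\boxtimes H_2$ is Cartesian (w.r.t. this factorization) if it is an edge of $H_1\Box H_2$,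 i.e. $|p_j(e)|=1$ for some $j$; otherwise it is non-Cartesian. -}

module Defs where

open import Data.Nat using (ℕ; _*_; _≤_; _⊔_; _⊓_)
open import Data.Bool using (Bool; true; false; _∨_)
open import Data.Fin using (Fin; combine)
open import Data.Fin.Subset using (Subset; _∈_; _⊆_; ∣_∣)
open import Data.Vec using (Vec; tabulate; lookup; foldr′)
open import Data.Product using (Σ; ∃; _×_; ∃-syntax)
open import Data.Sum using (_⊎_)
open import Relation.Binary.PropositionalEquality using (_≡_)
open import Relation.Binary.Construct.Closure.ReflexiveTransitive using (Star)

-- A hypergraph on the vertex set Fin n: the edge set is given as a
-- predicate on subsets of Fin n (finite since Subset n is finite).
record Hypergraph (n : ℕ) : Set₁ where
  field
    Edge : Subset n → Set
open Hypergraph public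

IsSimple : ∀ {n} → Hypergraph n → Set
IsSimple {n} H =
  (∀ e → Edge H e → 2 ≤ ∣ e ∣) ×
  (∀ e f → Edge H e → Edge H f → e ⊆ f → e ≡ f)

Adj : ∀ {n} → Hypergraph n → Fin n → Fin n → Set
Adj H x y = ∃[ e ] (Edge H e × x ∈ e × y ∈ e)

IsConnected : ∀ {n} → Hypergraph n → Set
IsConnected {n} H = (1 ≤ n) × (∀ x y → Star (Adj H) x y)

IsHypergraph : ∀ {n} → Hypergraph n → Set
IsHypergraph H = IsSimple H × IsConnected H

twoSection : ∀ {n} → Hypergraph n → Hypergraph n
Edge (twoSection H) s = (∣ s ∣ ≡ 2) × ∃[ e ] (Edge H e × s ⊆ e)

anyB : ∀ {m} → (Fin m → Bool) → Bool
anyB f = foldr′ _∨_ false (tabulate f)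

-- Vertex (x , y) of V₁ × V₂ is encoded as combine x y : Fin (n₁ * n₂).
-- Projections p₁, p₂ of a subset of V₁ × V₂.
p₁ : ∀ {n₁ n₂} → Subset (n₁ * n₂) → Subset n₁
p₁ {n₁} {n₂} e = tabulate λ x → anyB λ (y : Fin n₂) → lookup e (combine x y)

p₂ : ∀ {n₁ n₂} → Subset (n₁ * n₂) → Subset n₂
p₂ {n₁} {n₂} e = tabulate λ y → anyB λ (x : Fin n₁) → lookup e (combine x y)

CartEdge : ∀ {n₁ n₂} → Hypergraph n₁ → Hypergraph n₂ → Subset (n₁ * n₂) → Set
CartEdge {n₁} {n₂} H₁ H₂ e =
  (Edge H₁ (p₁ {n₁} {n₂} e) × ∣ p₂ {n₁} {n₂} e ∣ ≡ 1) ⊎ (Edge H₂ (p₂ {n₁} {n₂} e) × ∣ p₁ {n₁} {n₂} e ∣ ≡ 1)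

cartesian : ∀ {n₁ n₂} → Hypergraph n₁ → Hypergraph n₂ → Hypergraph (n₁ * n₂)
Edge (cartesian H₁ H₂) = CartEdge H₁ H₂

data ProductKind : Set where
  normal strong : ProductKind

StrongExtra : ∀ {n₁ n₂} → Hypergraph n₁ → Hypergraph n₂ → Subset (n₁ * n₂) → Set
StrongExtra {n₁} {n₂} H₁ H₂ e =
  Edge H₁ (p₁ {n₁} {n₂} e) × Edge H₂ (p₂ {n₁} {n₂} e) × ∣ e ∣ ≡ ∣ p₁ {n₁} {n₂} e ∣ ⊔ ∣ p₂ {n₁} {n₂} e ∣

NormalExtra : ∀ {n₁ n₂} → Hypergraph n₁ → Hypergraph n₂ → Subset (n₁ * n₂) → Set
NormalExtra {n₁} {n₂} H₁ H₂ e =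
  Σ (Subset n₁) λ e₁ → Σ (Subset n₂) λ e₂ →
    Edge H₁ e₁ × Edge H₂ e₂ × p₁ {n₁} {n₂} e ⊆ e₁ × p₂ {n₁} {n₂} e ⊆ e₂ ×
    ∣ e ∣ ≡ ∣ e₁ ∣ ⊓ ∣ e₂ ∣ × ∣ p₁ {n₁} {n₂} e ∣ ≡ ∣ e₁ ∣ ⊓ ∣ e₂ ∣ ×
    ∣ p₂ {n₁} {n₂} e ∣ ≡ ∣ e₁ ∣ ⊓ ∣ e₂ ∣

prod : ProductKind → ∀ {n₁ n₂} → Hypergraph n₁ → Hypergraph n₂ → Hypergraph (n₁ * n₂)
Edge (prod normal H₁ H₂) e = CartEdge H₁ H₂ e ⊎ NormalExtra H₁ H₂ e
Edge (prod strong H₁ H₂) e = CartEdge H₁ H₂ e ⊎ StrongExtra H₁ H₂ e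

-- A Cartesian edge lies in a single layer of the product, so each of its
-- 2-subsets {u, v} agrees in one coordinate and differs in the other:
-- it is a Cartesian edge of [H₁]₂ ⊠ [H₂]₂. A non-Cartesian edge has both
-- projections of size at least 2 (edges of the factors have at least two
-- vertices), and then it contains two vertices differing in both
-- coordinates; this pair is a non-Cartesian edge of the 2-section.
module Submission where

open import Defs
open import Data.Nat using (ℕ; _*_)
open import Data.Fin.Subset using (Subset; _⊆_)
open import Function.Bundles using (_⇔_)

open import Data.Bool using (Bool; true; false)
open import Data.Empty using (⊥-elim)
open import Data.Fin using (Fin; zero; suc; combine; remQuot)
open import Data.Fin.Properties using (_≟_; suc-injective; combine-remQuot; remQuot-combine)
open import Data.Fin.Subset using (_∈_; ∣_∣; ⁅_⁆; _∪_; _-_; Nonempty; inside; outside)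
open import Data.Fin.Subset.Properties
  using (x∈p⇒∣p-x∣<∣p∣; x∈p∧x≢y⇒x∈p-y; x∈⁅x⁆; x∈⁅y⁆⇒x≡y; ∣⁅x⁆∣≡1;
         x∈p∪q⁺; x∈p∪q⁻; ∪-idem; ⊆-antisym)
open import Data.Nat as ℕ using (_+_; _≤_; _<_; z≤n; s≤s)
open import Data.Nat.Properties
  using (≤-trans; ≤-reflexive; ≤-antisym; <⇒≱; +-suc; n≤1+n; +-monoʳ-≤; ⊓-glb)
open import Data.Product using (∃; ∃₂; _×_; _,_; proj₁; proj₂)
open import Data.Sum using (_⊎_; inj₁; inj₂; [_,_]′)
open import Data.Vec using ([]; _∷_; here; there; lookup; tabulate)
open import Data.Vec.Properties using (lookup∘tabulate; []=⇒lookup; lookup⇒[]=)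
open import Function using (_∘_; id)
open import Function.Bundles using (mk⇔)
open import Relation.Binary.PropositionalEquality
open import Relation.Nullary using (¬_; yes; no)

private
  variable
    n : ℕ
    p : Subset n
    x y : Fin n

∣p∪q∣≤∣p∣+∣q∣ : (p q : Subset n) → ∣ p ∪ q ∣ ≤ ∣ p ∣ + ∣ q ∣
∣p∪q∣≤∣p∣+∣q∣ []           []           = z≤n
∣p∪q∣≤∣p∣+∣q∣ (inside ∷ p)  (inside ∷ q)  =
  s≤s (≤-trans (∣p∪q∣≤∣p∣+∣q∣ p q) (+-monoʳ-≤ ∣ p ∣ (n≤1+n ∣ q ∣)))
∣p∪q∣≤∣p∣+∣q∣ (inside ∷ p)  (outside ∷ q) = s≤s (∣p∪q∣≤∣p∣+∣q∣ p q)
∣p∪q∣≤∣p∣+∣q∣ (outside ∷ p) (inside ∷ q)  =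
  ≤-trans (s≤s (∣p∪q∣≤∣p∣+∣q∣ p q)) (≤-reflexive (sym (+-suc ∣ p ∣ ∣ q ∣)))
∣p∪q∣≤∣p∣+∣q∣ (outside ∷ p) (outside ∷ q) = ∣p∪q∣≤∣p∣+∣q∣ p q

x∈p⇒0<∣p∣ : x ∈ p → 0 < ∣ p ∣
x∈p⇒0<∣p∣ x∈p = ≤-trans (s≤s z≤n) (x∈p⇒∣p-x∣<∣p∣ x∈p)

x≢y⇒2≤∣p∣ : x ∈ p → y ∈ p → x ≢ y → 2 ≤ ∣ p ∣
x≢y⇒2≤∣p∣ x∈p y∈p x≢y =
  ≤-trans (s≤s (x∈p⇒0<∣p∣ (x∈p∧x≢y⇒x∈p-y y∈p (x≢y ∘ sym)))) (x∈p⇒∣p-x∣<∣p∣ x∈p)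

∣p∣≤1⇒x≡y : ∣ p ∣ ≤ 1 → x ∈ p → y ∈ p → x ≡ y
∣p∣≤1⇒x≡y {x = x} {y = y} ∣p∣≤1 x∈p y∈p with x ≟ y
... | yes x≡y = x≡y
... | no  x≢y = ⊥-elim (<⇒≱ (x≢y⇒2≤∣p∣ x∈p y∈p x≢y) ∣p∣≤1)

0<∣p∣⇒nonempty : 0 < ∣ p ∣ → Nonempty p
0<∣p∣⇒nonempty {p = inside  ∷ p} _     = zero , here
0<∣p∣⇒nonempty {p = outside ∷ p} 0<∣p∣ with x , x∈p ← 0<∣p∣⇒nonempty 0<∣p∣ = suc x , there x∈p

2≤∣p∣⇒distinct : 2 ≤ ∣ p ∣ → ∃₂ λ x y → x ∈ p × y ∈ p × x ≢ y
2≤∣p∣⇒distinct {p = inside ∷ p} (s≤s 0<∣p∣) with y , y∈p ← 0<∣p∣⇒nonempty 0<∣p∣ =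
  zero , suc y , here , there y∈p , λ ()
2≤∣p∣⇒distinct {p = outside ∷ p} 2≤∣p∣
  with x , y , x∈p , y∈p , x≢y ← 2≤∣p∣⇒distinct 2≤∣p∣ =
  suc x , suc y , there x∈p , there y∈p , x≢y ∘ suc-injective

x∈⁅y⁆∪⁅z⁆⁻ : ∀ {z : Fin n} → x ∈ ⁅ y ⁆ ∪ ⁅ z ⁆ → x ≡ y ⊎ x ≡ z
x∈⁅y⁆∪⁅z⁆⁻ {y = y} {z = z} x∈ with x∈p∪q⁻ ⁅ y ⁆ ⁅ z ⁆ x∈
... | inj₁ x∈⁅y⁆ = inj₁ (x∈⁅y⁆⇒x≡y y x∈⁅y⁆)
... | inj₂ x∈⁅z⁆ = inj₂ (x∈⁅y⁆⇒x≡y z x∈⁅z⁆)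

⁅x⁆∪⁅y⁆⊆p : x ∈ p → y ∈ p → ⁅ x ⁆ ∪ ⁅ y ⁆ ⊆ p
⁅x⁆∪⁅y⁆⊆p {p = p} x∈p y∈p z∈ with x∈⁅y⁆∪⁅z⁆⁻ z∈
... | inj₁ refl = x∈p
... | inj₂ refl = y∈p

∣⁅x⁆∪⁅y⁆∣≡2 : x ≢ y → ∣ ⁅ x ⁆ ∪ ⁅ y ⁆ ∣ ≡ 2
∣⁅x⁆∪⁅y⁆∣≡2 {x = x} {y = y} x≢y = ≤-antisym
  (≤-trans (∣p∪q∣≤∣p∣+∣q∣ ⁅ x ⁆ ⁅ y ⁆) (≤-reflexive (cong₂ _+_ (∣⁅x⁆∣≡1 x) (∣⁅x⁆∣≡1 y))))
  (x≢y⇒2≤∣p∣ (x∈p∪q⁺ (inj₁ (x∈⁅x⁆ x))) (x∈p∪q⁺ (inj₂ (x∈⁅x⁆ y))) x≢y)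

∣⁅x⁆∪⁅x⁆∣≡1 : (x : Fin n) → ∣ ⁅ x ⁆ ∪ ⁅ x ⁆ ∣ ≡ 1
∣⁅x⁆∪⁅x⁆∣≡1 x = trans (cong ∣_∣ (∪-idem ⁅ x ⁆)) (∣⁅x⁆∣≡1 x)

∣p∣≡2⇒p≡⁅x⁆∪⁅y⁆ : ∣ p ∣ ≡ 2 → ∃₂ λ x y → x ≢ y × p ≡ ⁅ x ⁆ ∪ ⁅ y ⁆
∣p∣≡2⇒p≡⁅x⁆∪⁅y⁆ {p = p} ∣p∣≡2
  with x , y , x∈p , y∈p , x≢y ← 2≤∣p∣⇒distinct (≤-reflexive (sym ∣p∣≡2)) =
  x , y , x≢y , ⊆-antisym p⊆⁅x⁆∪⁅y⁆ (⁅x⁆∪⁅y⁆⊆p x∈p y∈p)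
  where
  -- A third element z would give two elements z, y of p - x, so 2 < ∣ p ∣.
  p⊆⁅x⁆∪⁅y⁆ : p ⊆ ⁅ x ⁆ ∪ ⁅ y ⁆
  p⊆⁅x⁆∪⁅y⁆ {z} z∈p with z ≟ x | z ≟ y
  ... | yes refl | _        = x∈p∪q⁺ (inj₁ (x∈⁅x⁆ x))
  ... | no  _    | yes refl = x∈p∪q⁺ (inj₂ (x∈⁅x⁆ y))
  ... | no  z≢x  | no  z≢y  =
    ⊥-elim (<⇒≱ (≤-trans (s≤s 2≤∣p-x∣) (x∈p⇒∣p-x∣<∣p∣ x∈p)) (≤-reflexive ∣p∣≡2))
    where
    2≤∣p-x∣ : 2 ≤ ∣ p - x ∣
    2≤∣p-x∣ = x≢y⇒2≤∣p∣ (x∈p∧x≢y⇒x∈p-y z∈p z≢x) (x∈p∧x≢y⇒x∈p-y y∈p (x≢y ∘ sym)) z≢y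

record IsImage {N m : ℕ} (f : Fin N → Fin m) (P : Subset N → Subset m) : Set where
  field
    image⁺ : ∀ {e u} → u ∈ e → f u ∈ P e
    image⁻ : ∀ {e x} → x ∈ P e → ∃ λ u → u ∈ e × f u ≡ x

  image-mono : ∀ {e e′} → e ⊆ e′ → P e ⊆ P e′
  image-mono e⊆e′ x∈ with u , u∈e , refl ← image⁻ x∈ = image⁺ (e⊆e′ u∈e)

  image-constant : ∀ {e u v} → ∣ P e ∣ ≤ 1 → u ∈ e → v ∈ e → f u ≡ f v
  image-constant ∣Pe∣≤1 u∈e v∈e = ∣p∣≤1⇒x≡y ∣Pe∣≤1 (image⁺ u∈e) (image⁺ v∈e)

  image-separates : ∀ {e} → 2 ≤ ∣ P e ∣ → ∃₂ λ u v → u ∈ e × v ∈ e × f u ≢ f v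
  image-separates 2≤∣Pe∣
    with x , y , x∈ , y∈ , x≢y ← 2≤∣p∣⇒distinct 2≤∣Pe∣
    with image⁻ x∈ | image⁻ y∈
  ... | u , u∈e , refl | v , v∈e , refl = u , v , u∈e , v∈e , x≢y

  image-⁅x⁆∪⁅y⁆ : ∀ u v → P (⁅ u ⁆ ∪ ⁅ v ⁆) ≡ ⁅ f u ⁆ ∪ ⁅ f v ⁆
  image-⁅x⁆∪⁅y⁆ u v = ⊆-antisym P⊆ (⁅x⁆∪⁅y⁆⊆p (image⁺ u∈) (image⁺ v∈))
    where
    u∈ : u ∈ ⁅ u ⁆ ∪ ⁅ v ⁆
    u∈ = x∈p∪q⁺ (inj₁ (x∈⁅x⁆ u))
    v∈ : v ∈ ⁅ u ⁆ ∪ ⁅ v ⁆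
    v∈ = x∈p∪q⁺ (inj₂ (x∈⁅x⁆ v))
    P⊆ : P (⁅ u ⁆ ∪ ⁅ v ⁆) ⊆ ⁅ f u ⁆ ∪ ⁅ f v ⁆
    P⊆ x∈ with w , w∈ , refl ← image⁻ x∈ with x∈⁅y⁆∪⁅z⁆⁻ w∈
    ... | inj₁ refl = x∈p∪q⁺ (inj₁ (x∈⁅x⁆ (f u)))
    ... | inj₂ refl = x∈p∪q⁺ (inj₂ (x∈⁅x⁆ (f v)))

  ∣image-⁅x⁆∪⁅y⁆∣≡2 : ∀ {u v} → f u ≢ f v → ∣ P (⁅ u ⁆ ∪ ⁅ v ⁆) ∣ ≡ 2
  ∣image-⁅x⁆∪⁅y⁆∣≡2 {u} {v} fu≢fv = trans (cong ∣_∣ (image-⁅x⁆∪⁅y⁆ u v)) (∣⁅x⁆∪⁅y⁆∣≡2 fu≢fv)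

open IsImage

module _ {N : ℕ} {e : Subset N} where

  separates⇒avoids : ∀ {m} (g : Fin N → Fin m) {w w′} → w ∈ e → w′ ∈ e → g w ≢ g w′ →
    (c : Fin m) → ∃ λ z → z ∈ e × g z ≢ c
  separates⇒avoids g {w} {w′} w∈e w′∈e gw≢gw′ c with g w ≟ c
  ... | no  gw≢c = w , w∈e , gw≢c
  ... | yes refl = w′ , w′∈e , gw≢gw′ ∘ sym

  separates-both : ∀ {m₁ m₂} (f : Fin N → Fin m₁) (g : Fin N → Fin m₂) →
    (∃₂ λ u v → u ∈ e × v ∈ e × f u ≢ f v) →
    (∃₂ λ w w′ → w ∈ e × w′ ∈ e × g w ≢ g w′) →
    ∃₂ λ u v → u ∈ e × v ∈ e × f u ≢ f v × g u ≢ g v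
  separates-both f g (u , v , u∈e , v∈e , fu≢fv) (w , w′ , w∈e , w′∈e , gw≢gw′) with g u ≟ g v
  ... | no  gu≢gv = u , v , u∈e , v∈e , fu≢fv , gu≢gv
  ... | yes gu≡gv with z , z∈e , gz≢gu ← separates⇒avoids g w∈e w′∈e gw≢gw′ (g u) with f z ≟ f u
  ...   | no  fz≢fu = u , z , u∈e , z∈e , fz≢fu ∘ sym , gz≢gu ∘ sym
  ...   | yes fz≡fu = v , z , v∈e , z∈e ,
            (λ fv≡fz → fu≢fv (sym (trans fv≡fz fz≡fu))) ,
            (λ gv≡gz → gz≢gu (sym (trans gu≡gv gv≡gz)))

module _ {N m₁ m₂ : ℕ} {f₁ : Fin N → Fin m₁} {P₁ : Subset N → Subset m₁}
         {f₂ : Fin N → Fin m₂} {P₂ : Subset N → Subset m₂}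
         (isImage₁ : IsImage f₁ P₁) (isImage₂ : IsImage f₂ P₂)
         (jointly-injective : ∀ {u v} → f₁ u ≡ f₁ v → f₂ u ≡ f₂ v → u ≡ v) where

  pair-in-fibre : ∀ {e e′} → ∣ P₂ e ∣ ≤ 1 → e′ ⊆ e → ∣ e′ ∣ ≡ 2 →
    ∣ P₁ e′ ∣ ≡ 2 × ∣ P₂ e′ ∣ ≡ 1
  pair-in-fibre {e′ = e′} ∣P₂e∣≤1 e′⊆e ∣e′∣≡2
    with u , v , u≢v , refl ← ∣p∣≡2⇒p≡⁅x⁆∪⁅y⁆ {p = e′} ∣e′∣≡2 =
    ∣image-⁅x⁆∪⁅y⁆∣≡2 isImage₁ (λ f₁u≡f₁v → u≢v (jointly-injective f₁u≡f₁v f₂u≡f₂v)) ,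
    (begin
      ∣ P₂ (⁅ u ⁆ ∪ ⁅ v ⁆) ∣   ≡⟨ cong ∣_∣ (image-⁅x⁆∪⁅y⁆ isImage₂ u v) ⟩
      ∣ ⁅ f₂ u ⁆ ∪ ⁅ f₂ v ⁆ ∣  ≡⟨ cong (λ y → ∣ ⁅ f₂ u ⁆ ∪ ⁅ y ⁆ ∣) f₂u≡f₂v ⟨
      ∣ ⁅ f₂ u ⁆ ∪ ⁅ f₂ u ⁆ ∣  ≡⟨ ∣⁅x⁆∪⁅x⁆∣≡1 (f₂ u) ⟩
      1                        ∎)
    where
    open ≡-Reasoning
    f₂u≡f₂v : f₂ u ≡ f₂ v
    f₂u≡f₂v = image-constant isImage₂ ∣P₂e∣≤1
      (e′⊆e (x∈p∪q⁺ (inj₁ (x∈⁅x⁆ u)))) (e′⊆e (x∈p∪q⁺ (inj₂ (x∈⁅x⁆ v))))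

anyB⁻ : ∀ {m} (g : Fin m → Bool) → anyB g ≡ true → ∃ λ i → g i ≡ true
anyB⁻ {ℕ.suc m} g any≡true with g zero in g0≡true
... | true  = zero , g0≡true
... | false with i , gi≡true ← anyB⁻ (g ∘ suc) any≡true = suc i , gi≡true

anyB⁺ : ∀ {m} (g : Fin m → Bool) (i : Fin m) → g i ≡ true → anyB g ≡ true
anyB⁺ g zero    g0≡true rewrite g0≡true = refl
anyB⁺ g (suc i) gi≡true with g zero
... | true  = refl
... | false = anyB⁺ (g ∘ suc) i gi≡true

∈-tabulate⁺ : ∀ {m} {g : Fin m → Bool} {i} → g i ≡ true → i ∈ tabulate g
∈-tabulate⁺ {g = g} {i} gi≡true = lookup⇒[]= i (tabulate g) (trans (lookup∘tabulate g i) gi≡true)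

∈-tabulate⁻ : ∀ {m} {g : Fin m → Bool} {i} → i ∈ tabulate g → g i ≡ true
∈-tabulate⁻ {g = g} {i} i∈ = trans (sym (lookup∘tabulate g i)) ([]=⇒lookup i∈)

NontrivialEdges : Hypergraph n → Set
NontrivialEdges H = ∀ f → Edge H f → 2 ≤ ∣ f ∣

module _ {n₁ n₂ : ℕ} where

  π₁ : Fin (n₁ * n₂) → Fin n₁
  π₁ u = proj₁ (remQuot {n₁} n₂ u)

  π₂ : Fin (n₁ * n₂) → Fin n₂
  π₂ u = proj₂ (remQuot {n₁} n₂ u)

  combine-π : (u : Fin (n₁ * n₂)) → combine (π₁ u) (π₂ u) ≡ u
  combine-π = combine-remQuot {n₁} n₂

  π-injective : ∀ {u v} → π₁ u ≡ π₁ v → π₂ u ≡ π₂ v → u ≡ v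
  π-injective {u} {v} π₁u≡π₁v π₂u≡π₂v = begin
    u                        ≡⟨ combine-π u ⟨
    combine (π₁ u) (π₂ u)    ≡⟨ cong₂ combine π₁u≡π₁v π₂u≡π₂v ⟩
    combine (π₁ v) (π₂ v)    ≡⟨ combine-π v ⟩
    v                        ∎
    where open ≡-Reasoning

  p₁-isImage : IsImage π₁ (p₁ {n₁} {n₂})
  p₁-isImage = record { image⁺ = image⁺′ ; image⁻ = image⁻′ }
    where
    image⁺′ : ∀ {e u} → u ∈ e → π₁ u ∈ p₁ {n₁} {n₂} e
    image⁺′ {e} {u} u∈e = ∈-tabulate⁺ (anyB⁺ _ (π₂ u)
      ([]=⇒lookup (subst (_∈ e) (sym (combine-π u)) u∈e)))
    image⁻′ : ∀ {e x} → x ∈ p₁ {n₁} {n₂} e → ∃ λ u → u ∈ e × π₁ u ≡ x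
    image⁻′ {e} {x} x∈
      with y , lookup≡true ← anyB⁻ (λ (y : Fin n₂) → lookup e (combine x y)) (∈-tabulate⁻ x∈) =
      combine x y , lookup⇒[]= _ e lookup≡true , cong proj₁ (remQuot-combine x y)

  p₂-isImage : IsImage π₂ (p₂ {n₁} {n₂})
  p₂-isImage = record { image⁺ = image⁺′ ; image⁻ = image⁻′ }
    where
    image⁺′ : ∀ {e u} → u ∈ e → π₂ u ∈ p₂ {n₁} {n₂} e
    image⁺′ {e} {u} u∈e = ∈-tabulate⁺ (anyB⁺ _ (π₁ u)
      ([]=⇒lookup (subst (_∈ e) (sym (combine-π u)) u∈e)))
    image⁻′ : ∀ {e y} → y ∈ p₂ {n₁} {n₂} e → ∃ λ u → u ∈ e × π₂ u ≡ y
    image⁻′ {e} {y} y∈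
      with x , lookup≡true ← anyB⁻ (λ (x : Fin n₁) → lookup e (combine x y)) (∈-tabulate⁻ y∈) =
      combine x y , lookup⇒[]= _ e lookup≡true , cong proj₂ (remQuot-combine x y)

  Wide : Subset (n₁ * n₂) → Set
  Wide e = 2 ≤ ∣ p₁ {n₁} {n₂} e ∣ × 2 ≤ ∣ p₂ {n₁} {n₂} e ∣

  module _ {G₁ : Hypergraph n₁} {G₂ : Hypergraph n₂} where

    π-separated⇒¬cartesian : ∀ {u v} → π₁ u ≢ π₁ v → π₂ u ≢ π₂ v →
      ¬ CartEdge G₁ G₂ (⁅ u ⁆ ∪ ⁅ v ⁆)
    π-separated⇒¬cartesian _ π₂u≢π₂v (inj₁ (_ , ∣p₂∣≡1))
      with () ← trans (sym ∣p₂∣≡1) (∣image-⁅x⁆∪⁅y⁆∣≡2 p₂-isImage π₂u≢π₂v)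
    π-separated⇒¬cartesian π₁u≢π₁v _ (inj₂ (_ , ∣p₁∣≡1))
      with () ← trans (sym ∣p₁∣≡1) (∣image-⁅x⁆∪⁅y⁆∣≡2 p₁-isImage π₁u≢π₁v)

    wide⇒non-cartesian-pair : ∀ {e} → Wide e → ∃ λ e′ → ∣ e′ ∣ ≡ 2 × e′ ⊆ e × ¬ CartEdge G₁ G₂ e′
    wide⇒non-cartesian-pair (2≤∣p₁e∣ , 2≤∣p₂e∣)
      with u , v , u∈e , v∈e , π₁u≢π₁v , π₂u≢π₂v ←
             separates-both π₁ π₂ (image-separates p₁-isImage 2≤∣p₁e∣)
                                  (image-separates p₂-isImage 2≤∣p₂e∣) =
      ⁅ u ⁆ ∪ ⁅ v ⁆ , ∣⁅x⁆∪⁅y⁆∣≡2 (π₁u≢π₁v ∘ cong π₁) , ⁅x⁆∪⁅y⁆⊆p u∈e v∈e ,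
      π-separated⇒¬cartesian π₁u≢π₁v π₂u≢π₂v

  module _ {H₁ : Hypergraph n₁} {H₂ : Hypergraph n₂} where

    cartesian⇒pairs-cartesian : ∀ {e e′} → CartEdge H₁ H₂ e → e′ ⊆ e → ∣ e′ ∣ ≡ 2 →
      CartEdge (twoSection H₁) (twoSection H₂) e′
    cartesian⇒pairs-cartesian {e} (inj₁ (E₁ , ∣p₂e∣≡1)) e′⊆e ∣e′∣≡2 =
      let ∣p₁e′∣≡2 , ∣p₂e′∣≡1 = pair-in-fibre p₁-isImage p₂-isImage π-injective
                                  (≤-reflexive ∣p₂e∣≡1) e′⊆e ∣e′∣≡2
      in inj₁ ((∣p₁e′∣≡2 , p₁ {n₁} {n₂} e , E₁ , image-mono p₁-isImage e′⊆e) , ∣p₂e′∣≡1)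
    cartesian⇒pairs-cartesian {e} (inj₂ (E₂ , ∣p₁e∣≡1)) e′⊆e ∣e′∣≡2 =
      let ∣p₂e′∣≡2 , ∣p₁e′∣≡1 = pair-in-fibre p₂-isImage p₁-isImage
                                  (λ eq₂ eq₁ → π-injective eq₁ eq₂)
                                  (≤-reflexive ∣p₁e∣≡1) e′⊆e ∣e′∣≡2
      in inj₂ ((∣p₂e′∣≡2 , p₂ {n₁} {n₂} e , E₂ , image-mono p₂-isImage e′⊆e) , ∣p₁e′∣≡1)

    prodEdge⇒cartesian⊎wide : NontrivialEdges H₁ → NontrivialEdges H₂ →
      ∀ k {e} → Edge (prod k H₁ H₂) e → CartEdge H₁ H₂ e ⊎ Wide e
    prodEdge⇒cartesian⊎wide _ _ normal (inj₁ cart) = inj₁ cart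
    prodEdge⇒cartesian⊎wide _ _ strong (inj₁ cart) = inj₁ cart
    prodEdge⇒cartesian⊎wide large₁ large₂ strong (inj₂ (E₁ , E₂ , _)) =
      inj₂ (large₁ _ E₁ , large₂ _ E₂)
    prodEdge⇒cartesian⊎wide large₁ large₂ normal
      (inj₂ (e₁ , e₂ , E₁ , E₂ , _ , _ , _ , ∣p₁e∣≡min , ∣p₂e∣≡min)) =
      inj₂ (subst (2 ≤_) (sym ∣p₁e∣≡min) 2≤min , subst (2 ≤_) (sym ∣p₂e∣≡min) 2≤min)
      where
      2≤min : 2 ≤ ∣ e₁ ∣ ℕ.⊓ ∣ e₂ ∣
      2≤min = ⊓-glb (large₁ e₁ E₁) (large₂ e₂ E₂)

    pairs-cartesian⇒cartesian : NontrivialEdges H₁ → NontrivialEdges H₂ →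
      ∀ k {e} → Edge (prod k H₁ H₂) e →
      (∀ e′ → Edge (twoSection (prod k H₁ H₂)) e′ → e′ ⊆ e →
         CartEdge (twoSection H₁) (twoSection H₂) e′) →
      CartEdge H₁ H₂ e
    pairs-cartesian⇒cartesian large₁ large₂ k {e} E pairs-cartesian =
      [ id , refute ]′ (prodEdge⇒cartesian⊎wide large₁ large₂ k E)
      where
      refute : Wide e → CartEdge H₁ H₂ e
      refute wide =
        let e′ , ∣e′∣≡2 , e′⊆e , ¬cart =
              wide⇒non-cartesian-pair {G₁ = twoSection H₁} {twoSection H₂} wide
        in ⊥-elim (¬cart (pairs-cartesian e′ (∣e′∣≡2 , e , E , e′⊆e) e′⊆e))

lemma3p7 : (k : ProductKind) {n₁ n₂ : ℕ} (H₁ : Hypergraph n₁) (H₂ : Hypergraph n₂) →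
    IsHypergraph H₁ → IsHypergraph H₂ →
    (e : Subset (n₁ * n₂)) → Edge (prod k H₁ H₂) e →
    (CartEdge H₁ H₂ e ⇔
      (∀ (e′ : Subset (n₁ * n₂)) → Edge (twoSection (prod k H₁ H₂)) e′ → e′ ⊆ e →
        CartEdge (twoSection H₁) (twoSection H₂) e′))
lemma3p7 k H₁ H₂ ((large₁ , _) , _) ((large₂ , _) , _) e E = mk⇔
  (λ cart e′ (∣e′∣≡2 , _) e′⊆e → cartesian⇒pairs-cartesian cart e′⊆e ∣e′∣≡2)
  (pairs-cartesian⇒cartesian large₁ large₂ k E)
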